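{- Let $\mathcal{C},\mathcal{D}$ be categories and $r>0$. Suppose $A,B,C\in\mathrm{Ob}(\mathcal{C})$ satisfy $C\to(B)^A_r$ in $\mathcal{C}$, $D,E\in\mathrm{Ob}(\mathcal{D})$, and $F\colon\mathrm{Hom}_{\mathcal{C}}(A,B)\to\mathrm{Hom}_{\mathcal{D}}(D,E)$ is a surjective function. If $\mathcal{D}$ has a cocone with vertex $W\in\mathrm{Ob}(\mathcal{D})$ over the transfer diagram $H$ (determined by $A,B,C,D,E,F$), then $W\to(E)^D_r$ in $\mathcal{D}$.
   Context: For $r>0$, an $r$-coloring of a set $S$ is a function $\chi\colon S\to\{0,\dots,r-1\}$; a subset is $\chi$-monochromatic if $\chi$ is constant on it. In a category $\mathcal{K}$, for objects $A,B,C$ we write $C\to(B)^A_r$ if for every $r$-coloring $\chi$ of $\mathrm{Hom}_{\mathcal{K}}(A,C)$ there is $g\in\mathrm{Hom}_{\mathcal{K}}(B,C)$ such that $\{g\circ f: f\in\mathrm{Hom}_{\mathcal{K}}(A,B)\}$ is $\chi$-monochromatic. Transfer diagram: let $J$ be the category with $\mathrm{Ob}(J)=\mathrm{Hom}_{\mathcal{C}}(A,C)\cup\mathrm{Hom}_{\mathcal{C}}(B,C)$, whose only non-identity morphisms are, for $h\in\mathrm{Hom}_{\mathcal{C}}(A,C)$ and $g\in\mathrm{Hom}_{\mathcal{C}}(B,C)$, the elements of $\mathrm{Hom}_J(h,g)=\{(h,g,f): f\in\mathrm{Hom}_{\mathcal{C}}(A,B),\ g\circ f=h\}$. The transfer diagram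 $H\colon J\to\mathcal{D}$ sends every $h\in\mathrm{Hom}_{\mathcal{C}}(A,C)$ to $D$, every $g\in\mathrm{Hom}_{\mathcal{C}}(B,C)$ to $E$, and each morphism $(h,g,f)$ to $F(f)$. -}

module Defs where

open import Level using (Level; _⊔_; suc)
open import Data.Nat using (ℕ)
open import Data.Fin using (Fin)
open import Data.Product using (Σ; ∃)
open import Relation.Binary.PropositionalEquality using (_≡_)

record Category (o ℓ : Level) : Set (suc (o ⊔ ℓ)) where
  infixr 9 _∘_
  field
    Obj  : Set o
    Hom  : Obj → Obj → Set ℓ
    id   : ∀ {A} → Hom A A
    _∘_  : ∀ {A B C} → Hom B C → Hom A B → Hom A C
    assoc     : ∀ {A B C D} (h : Hom C D) (g : Hom B C) (f : Hom A B) →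
                (h ∘ g) ∘ f ≡ h ∘ (g ∘ f)
    identityˡ : ∀ {A B} (f : Hom A B) → id ∘ f ≡ f
    identityʳ : ∀ {A B} (f : Hom A B) → f ∘ id ≡ f

Coloring : ∀ {a} → ℕ → Set a → Set a
Coloring r S = S → Fin r

-- A subset given as the image of a function e : I → S is χ-monochromatic
-- iff χ is constant on it.
Monochromatic : ∀ {a i} {S : Set a} {I : Set i} {r : ℕ} →
                Coloring r S → (I → S) → Set i
Monochromatic χ e = ∀ x y → χ (e x) ≡ χ (e y)

Arrow : ∀ {o ℓ} (𝒦 : Category o ℓ) (C B A : Category.Obj 𝒦) (r : ℕ) → Set ℓ
Arrow 𝒦 C B A r =
  (χ : Coloring r (Hom A C)) →
  Σ (Hom B C) (λ g → Monochromatic χ (λ (f : Hom A B) → g ∘ f))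
  where open Category 𝒦

-- A cocone with vertex W over the transfer diagram H : J → 𝒟 determined by
-- A, B, C (in 𝒞), D, E (in 𝒟) and F : Hom(A,B) → Hom(D,E).
-- Objects of J: Hom(A,C) ⊎ Hom(B,C) (disjoint); legs: λA h : D → W for
-- h ∈ Hom(A,C), λB g : E → W for g ∈ Hom(B,C); commutativity for each
-- morphism (h,g,f) of J (g ∘ f = h):  λB g ∘ F f = λA h.
-- (Identity morphisms of J impose no condition.)
record TransferCocone {o₁ ℓ₁ o₂ ℓ₂} (𝒞 : Category o₁ ℓ₁) (𝒟 : Category o₂ ℓ₂)
    (A B C : Category.Obj 𝒞) (D E : Category.Obj 𝒟)
    (F : Category.Hom 𝒞 A B → Category.Hom 𝒟 D E)
    (W : Category.Obj 𝒟) : Set (ℓ₁ ⊔ ℓ₂) where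
  private
    module 𝒞 = Category 𝒞
    module 𝒟 = Category 𝒟
  field
    legA : 𝒞.Hom A C → 𝒟.Hom D W
    legB : 𝒞.Hom B C → 𝒟.Hom E W
    commute : (h : 𝒞.Hom A C) (g : 𝒞.Hom B C) (f : 𝒞.Hom A B) →
              g 𝒞.∘ f ≡ h → legB g 𝒟.∘ F f ≡ legA h

{-# OPTIONS --safe #-}
-- Colour Hom(A,C) by pulling χ back along the A-legs of the cocone and pick a
-- g that is monochromatic for it. The cocone identifies legB g ∘ F f with
-- legA (g ∘ f), so legB g is monochromatic on every arrow of the form F f,
-- which by surjectivity of F is every arrow D → E.

module Submission where

open import Defs
open import Level using (Level)
open import Data.Nat using (ℕ; _>_)
open import Data.Product using (∃; _,_)
open import Relation.Binary.PropositionalEquality using (_≡_; refl)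
open import Function using (_∘_)

monochromatic-precomp-surjective :
  ∀ {a i j} {S : Set a} {I : Set i} {J : Set j} {r : ℕ}
  (χ : Coloring r S) (e : J → S) (F : I → J) →
  (∀ y → ∃ (λ x → F x ≡ y)) →
  Monochromatic χ (e ∘ F) → Monochromatic χ e
monochromatic-precomp-surjective χ e F surj mono y y′
  with surj y | surj y′
... | x , refl | x′ , refl = mono x x′

module _ {o₁ ℓ₁ o₂ ℓ₂} {𝒞 : Category o₁ ℓ₁} {𝒟 : Category o₂ ℓ₂}
         {A B C : Category.Obj 𝒞} {D E : Category.Obj 𝒟}
         {F : Category.Hom 𝒞 A B → Category.Hom 𝒟 D E}
         {W : Category.Obj 𝒟} (cocone : TransferCocone 𝒞 𝒟 A B C D E F W) where

  private
    module 𝒞 = Category 𝒞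
    module 𝒟 = Category 𝒟
  open TransferCocone cocone

  legB-∘-F : ∀ g f → legB g 𝒟.∘ F f ≡ legA (g 𝒞.∘ f)
  legB-∘-F g f = commute (g 𝒞.∘ f) g f refl

  legB-monochromatic : ∀ {r} (χ : Coloring r (𝒟.Hom D W)) g →
    Monochromatic (χ ∘ legA) (λ f → g 𝒞.∘ f) →
    Monochromatic χ (λ f → legB g 𝒟.∘ F f)
  legB-monochromatic χ g mono f f′ rewrite legB-∘-F g f | legB-∘-F g f′ =
    mono f f′

lemma2 : ∀ {o₁ ℓ₁ o₂ ℓ₂ : Level} (𝒞 : Category o₁ ℓ₁) (𝒟 : Category o₂ ℓ₂)
    (r : ℕ) → r > 0 →
    (A B C : Category.Obj 𝒞) → Arrow 𝒞 C B A r →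
    (D E : Category.Obj 𝒟) →
    (F : Category.Hom 𝒞 A B → Category.Hom 𝒟 D E) →
    (∀ (y : Category.Hom 𝒟 D E) → ∃ (λ x → F x ≡ y)) →
    (W : Category.Obj 𝒟) → TransferCocone 𝒞 𝒟 A B C D E F W →
    Arrow 𝒟 W E D r
lemma2 𝒞 𝒟 r _ A B C arrow D E F surj W cocone χ
  with arrow (χ ∘ TransferCocone.legA cocone)
... | g , mono =
  legB g , monochromatic-precomp-surjective χ (λ y → legB g 𝒟.∘ y) F surj
             (legB-monochromatic cocone χ g mono)
  where
    module 𝒟 = Category 𝒟
    open TransferCocone cocone using (legB)
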